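{- Let $T$ be a $7$-tournament with vertices $v_1,\dots,v_7$ such that $T[v_1,\dots,v_6]$ is isomorphic to $L_6$, $T[X]$ is transitive, $\psi_T(v_6,X)=(1,-1,1,-1,1)$ and $\psi_T(v_7,X)=(\alpha_1,\dots,\alpha_t)$, where $X=\{v_1,\dots,v_5\}$. Then (i) if $t\in\{1,2,5\}$, there exists $i\in\{1,\dots,6\}$ such that $v_7$ and $v_i$ are covertices or revertices in $T$; (ii) if $t\in\{3,4\}$, then $T\notin\mathcal{D}_5$.
   Context: A tournament is a directed graph with exactly one arc between each pair of distinct vertices; $u\rightarrow v$ means the arc goes from $u$ to $v$; $T[X]$ is the subtournament induced by $X$; transitive means no directed 3-cycle. For a tournament $T$ on vertices $w_1,\dots,w_n$, its skew-adjacency matrix is the zero-diagonal matrix $S_T=[s_{ij}]$ with $s_{ij}=-s_{ji}=1$ if $w_i\rightarrow w_j$, and $\det(T):=\det(S_T)$. $\mathcal{D}_5$ is the set of tournaments all of whose subtournaments (induced by nonempty vertex subsets, including $T$) have determinant at most $25$. $L_6$ is the tournament on $u_1,\dots,u_6$ with $u_a\rightarrow u_b$ for $1\le a<b\le 5$, $u_6\rightarrow u_1,u_3,u_5$ and $u_2,u_4\rightarrow u_6$. Definition of $\psi$: if $T[X]$ is transitive with $|X|=k$, ordered $x_1,\dots,x_k$ with $x_a\rightarrow x_b$ for $a<b$, and $u\notin X$, then $\psi_T(u,X)=(\alpha_1,\dots,\alpha_t)$ is the sequence of nonzero integers with $\sum|\alpha_i|=k$ and $\alpha_i\alpha_{i+1}<0$,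 such that for the consecutive blocks $X(i,\alpha_i)$ of $|\alpha_i|$ vertices in the order $x_1,\dots,x_k$, $u$ dominates all of $X(i,\alpha_i)$ if $\alpha_i>0$ and is dominated by all of it if $\alpha_i<0$. Distinct vertices $a,b$ of $T$ are covertices if for every other vertex $v$, $a\rightarrow v$ iff $b\rightarrow v$; revertices if for every other vertex $v$, $a\rightarrow v$ iff $v\rightarrow b$. -}

module Defs where

open import Data.Bool using (Bool; true; false; not; if_then_else_)
open import Data.Bool.Properties using () renaming (_≟_ to _≟ᵇ_)
open import Data.Nat using (ℕ; zero; suc; _<ᵇ_)
open import Data.Integer using (ℤ; +_; -_; _+_; _*_; 0ℤ; 1ℤ; _≤_)
open import Data.Fin using (Fin; zero; suc; toℕ; punchIn; inject₁; _↑ˡ_; _<_)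
open import Data.Fin.Subset using (Subset; Nonempty)
open import Data.List using (List; []; _∷_; map; length; lookup; tabulate)
open import Data.Vec using ([]; _∷_)
open import Data.Product using (Σ; _×_; ∃)
open import Data.Sum using (_⊎_)
open import Relation.Nullary using (¬_; does)
open import Relation.Binary.PropositionalEquality using (_≡_; _≢_)
open import Function.Bundles using (_↔_; Inverse)

record Tournament (n : ℕ) : Set where
  field
    arc     : Fin n → Fin n → Bool
    irrefl  : ∀ i → arc i i ≡ false
    oneArc  : ∀ i j → i ≢ j → arc j i ≡ not (arc i j)

open Tournament public

Matrix : ℕ → Set
Matrix n = Fin n → Fin n → ℤ

signℤ : ℕ → ℤ
signℤ zero          = 1ℤ
signℤ (suc zero)    = - 1ℤ
signℤ (suc (suc k)) = signℤ k

sumFin : ∀ {n} → (Fin n → ℤ) → ℤ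
sumFin {zero}  f = 0ℤ
sumFin {suc n} f = f zero + sumFin (λ i → f (suc i))

det : ∀ {n} → Matrix n → ℤ
det {zero}  M = 1ℤ
det {suc n} M =
  sumFin (λ j → signℤ (toℕ j) * (M zero j * det (λ k l → M (suc k) (punchIn j l))))

skew : ∀ {n} → Tournament n → Fin n → Fin n → ℤ
skew T i j with arc T i j | arc T j i
... | true  | _     = 1ℤ
... | false | true  = - 1ℤ
... | false | false = 0ℤ

elems : ∀ {n} → Subset n → List (Fin n)
elems []          = []
elems (true ∷ p)  = zero ∷ map suc (elems p)
elems (false ∷ p) = map suc (elems p)

inducedSkew : ∀ {n} → Tournament n → (X : Subset n) → Matrix (length (elems X))
inducedSkew T X i j = skew T (lookup (elems X) i) (lookup (elems X) j)

detSub : ∀ {n} → Tournament n → Subset n → ℤ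
detSub T X = det (inducedSkew T X)

InD5 : ∀ {n} → Tournament n → Set
InD5 T = ∀ X → Nonempty X → detSub T X ≤ + 25

Covertices : ∀ {n} → Tournament n → Fin n → Fin n → Set
Covertices T a b = a ≢ b × (∀ v → v ≢ a → v ≢ b → arc T a v ≡ arc T b v)

Revertices : ∀ {n} → Tournament n → Fin n → Fin n → Set
Revertices T a b = a ≢ b × (∀ v → v ≢ a → v ≢ b → arc T a v ≡ arc T v b)

-- The tournament L₆ on u₁,…,u₆ (u_k is index k-1 in Fin 6).

l6 : ℕ → ℕ → Bool
l6 5 0 = true
l6 5 2 = true
l6 5 4 = true
l6 5 _ = false
l6 1 5 = true
l6 3 5 = true
l6 _ 5 = false
l6 i j = i <ᵇ j

L6arc : Fin 6 → Fin 6 → Bool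
L6arc i j = l6 (toℕ i) (toℕ j)

-- Seven-vertex setting: v_k is index k-1 in Fin 7.
-- X = {v₁,…,v₅} embedded by _↑ˡ 2; {v₁,…,v₆} embedded by inject₁.

vX : Fin 5 → Fin 7
vX a = a ↑ˡ 2

v6 v7 : Fin 7
v6 = suc (suc (suc (suc (suc zero))))
v7 = suc (suc (suc (suc (suc (suc zero)))))

SixIsoL6 : Tournament 7 → Set
SixIsoL6 T = Σ (Fin 6 ↔ Fin 6) λ f →
  ∀ i j → arc T (inject₁ i) (inject₁ j) ≡ L6arc (Inverse.to f i) (Inverse.to f j)

TransitiveX : Tournament 7 → Set
TransitiveX T = ∀ a b c →
  ¬ (arc T (vX a) (vX b) ≡ true × arc T (vX b) (vX c) ≡ true × arc T (vX c) (vX a) ≡ true)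

-- π lists X in its transitive order: x_a = vX (π a), and x_a → x_b for a < b
IsTransOrder : Tournament 7 → (Fin 5 → Fin 5) → Set
IsTransOrder T π = ∀ a b → a < b → arc T (vX (π a)) (vX (π b)) ≡ true

-- ψ: run-length encoding with signs of the domination pattern.

signedRun : Bool → ℕ → ℤ
signedRun true  k = + k
signedRun false k = - (+ k)

runs : Bool → ℕ → List Bool → List ℤ
runs c k []       = signedRun c k ∷ []
runs c k (d ∷ ds) =
  if does (d ≟ᵇ c) then runs c (suc k) ds else (signedRun c k ∷ runs d 1 ds)

encode : List Bool → List ℤ
encode []       = []
encode (b ∷ bs) = runs b 1 bs

psi : Tournament 7 → (Fin 5 → Fin 5) → Fin 7 → List ℤ
psi T π u = encode (tabulate (λ a → arc T u (vX (π a))))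

-- Once X is listed in its transitive order x₁ → ⋯ → x₅, the whole of T is pinned down by
-- three pieces of data: the position ρ(k) of each vertex vX k in that order, the domination
-- pattern d of v₇ on x₁,…,x₅ (whose run-length encoding is ψ_T(v₇,X)), and the arc between
-- v₆ and v₇; the arcs of v₆ are forced by ψ_T(v₆,X) = (1,−1,1,−1,1), since encoding runs is
-- injective. So T coincides arc-for-arc with an explicit model tournament, and both parts of
-- the corollary become decidable properties of the model, checked by evaluation over all
-- 120 orders, 32 patterns and 2 choices of the remaining arc. For t ∈ {3,4} the witness
-- against 𝒟₅ is T with one vertex of X removed, a 6-tournament of determinant 49 or 81.
module Submission where

open import Defs
open import Data.Nat using (ℕ)
open import Data.Integer using (ℤ; +_; -_)
open import Data.Fin using (Fin; inject₁)
open import Data.List using (List; []; _∷_; length)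
open import Data.Product using (Σ; _×_)
open import Data.Sum using (_⊎_)
open import Relation.Nullary using (¬_)
open import Relation.Binary.PropositionalEquality using (_≡_)

open import Level using (0ℓ)
open import Data.Bool using (Bool; true; false; not; if_then_else_)
open import Data.Bool.Properties using () renaming (_≟_ to _≟ᵇ_)
import Data.Nat as ℕ
import Data.Nat.Properties as ℕ
open import Data.Integer using (-[1+_]; 1ℤ; 0ℤ; _*_; _+_; _<_; _≤_; _<?_)
open import Data.Integer.Properties using (<⇒≱)
open import Data.Fin using (zero; suc; toℕ; punchIn; punchOut; _↑ˡ_; _↑ʳ_; splitAt; #_; _≟_)
  renaming (_<_ to _<ᶠ_; _<?_ to _<ᶠ?_)
open import Data.Fin.Properties
  using (all?; any?; <-cmp; punchOut-injective; injective⇒≤; splitAt-↑ˡ; splitAt-↑ʳ)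
open import Data.Fin.Subset using (Subset; ⁅_⁆; ∁)
open import Data.Fin.Subset.Properties using (x∉p⇒x∈∁p; x≢y⇒x∉⁅y⁆)
open import Data.List using (replicate; _++_; tabulate; lookup)
open import Data.List.Properties using (∷-injective; tabulate-cong)
open import Data.Vec as Vec using (Vec; []; _∷_; removeAt)
open import Data.Vec.Properties using (lookup∘tabulate; lookup-map)
open import Data.Product using (_,_; ∃; proj₁; proj₂)
open import Data.Sum using (inj₁; inj₂)
import Data.Sum as Sum
open import Function using (_∘_)
open import Function.Definitions using (Injective)
open import Relation.Binary using (tri<; tri≈; tri>)
open import Relation.Nullary using (Dec; yes; no; does; _because_; _×-dec_; _⊎-dec_; _→-dec_; ¬?)
open import Relation.Nullary.Decidable using (map′; dec-true; dec-false)
open import Relation.Nullary.Negation using (contradiction)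
open import Relation.Nullary.Reflects using (invert)
open import Relation.Unary using (Pred; Decidable)
open import Relation.Binary.PropositionalEquality
  using (_≢_; refl; sym; trans; cong; cong₂; subst; module ≡-Reasoning)

private variable
  m n : ℕ

from-does : {A : Set} (a? : Dec A) → does a? ≡ true → A
from-does (true because [a]) _ = invert [a]

all-Bool? : {P : Pred Bool 0ℓ} → Decidable P → Dec (∀ b → P b)
all-Bool? P? = map′ (λ (p , q) → λ { true → p ; false → q }) (λ f → f true , f false)
                    (P? true ×-dec P? false)

all-Vec? : {A : Set} → (∀ {P : Pred A 0ℓ} → Decidable P → Dec (∀ x → P x)) →
           {P : Pred (Vec A n) 0ℓ} → Decidable P → Dec (∀ xs → P xs)
all-Vec? {n = ℕ.zero}  all-A? P? = map′ (λ { p [] → p }) (λ f → f []) (P? [])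
all-Vec? {n = ℕ.suc n} all-A? P? =
  map′ (λ f → λ { (x ∷ xs) → f x xs }) (λ f x xs → f (x ∷ xs))
       (all-A? λ x → all-Vec? all-A? λ xs → P? (x ∷ xs))

injective? : (f : Fin m → Fin n) → Dec (Injective _≡_ _≡_ f)
injective? f = map′ (λ inj {a} {c} → inj a c) (λ inj a c → inj {a} {c})
                    (all? λ a → all? λ c → f a ≟ f c →-dec a ≟ c)

injective⇒surjective : {f : Fin n → Fin n} → Injective _≡_ _≡_ f →
                       ∀ k → ∃ λ a → f a ≡ k
injective⇒surjective {ℕ.suc n} {f} f-inj k with any? (λ a → f a ≟ k)
... | yes hit  = hit
... | no  miss = contradiction (injective⇒≤ g-inj) ℕ.1+n≰n
  where
  k≢f : ∀ a → k ≢ f a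
  k≢f a k≡fa = miss (a , sym k≡fa)
  g : Fin (ℕ.suc n) → Fin n
  g a = punchOut (k≢f a)
  g-inj : Injective _≡_ _≡_ g
  g-inj ga≡gc = f-inj (punchOut-injective (k≢f _) (k≢f _) ga≡gc)

↑ˡ≢↑ʳ : (i : Fin m) (j : Fin n) → i ↑ˡ n ≢ m ↑ʳ j
↑ˡ≢↑ʳ {m} {n} i j eq = contradiction (begin
  inj₁ i                ≡⟨ splitAt-↑ˡ m i n ⟨
  splitAt m (i ↑ˡ n)    ≡⟨ cong (splitAt m) eq ⟩
  splitAt m (m ↑ʳ j)    ≡⟨ splitAt-↑ʳ m n j ⟩
  inj₂ j                ∎) λ ()
  where open ≡-Reasoning

removeAt-punchIn : {A : Set} (xs : Vec A (ℕ.suc n)) (i : Fin (ℕ.suc n)) (j : Fin n) →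
                   Vec.lookup (removeAt xs i) j ≡ Vec.lookup xs (punchIn i j)
removeAt-punchIn (x ∷ xs)     zero    j       = refl
removeAt-punchIn (x ∷ y ∷ xs) (suc i) zero    = refl
removeAt-punchIn (x ∷ y ∷ xs) (suc i) (suc j) = removeAt-punchIn (y ∷ xs) i j

-- Run-length encoding is injective

decodeRun : ℤ → List Bool
decodeRun (+ k)        = replicate k true
decodeRun -[1+ k ]     = replicate (ℕ.suc k) false

decode : List ℤ → List Bool
decode []       = []
decode (α ∷ αs) = decodeRun α ++ decode αs

replicate-++-∷ : {A : Set} (k : ℕ) (c : A) (xs : List A) →
                 replicate k c ++ c ∷ xs ≡ c ∷ replicate k c ++ xs
replicate-++-∷ ℕ.zero    c xs = refl
replicate-++-∷ (ℕ.suc k) c xs = cong (c ∷_) (replicate-++-∷ k c xs)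

decode-runs : ∀ c k bs → decode (runs c (ℕ.suc k) bs) ≡ replicate (ℕ.suc k) c ++ bs
decode-runs true  k []       = refl
decode-runs false k []       = refl
decode-runs c     k (b ∷ bs) with b ≟ᵇ c
... | yes refl = trans (decode-runs b (ℕ.suc k) bs) (cong (b ∷_) (sym (replicate-++-∷ k b bs)))
... | no  _    = cong₂ _++_ (decodeRun-signedRun c) (decode-runs b 0 bs)
  where
  decodeRun-signedRun : ∀ c → decodeRun (signedRun c (ℕ.suc k)) ≡ replicate (ℕ.suc k) c
  decodeRun-signedRun true  = refl
  decodeRun-signedRun false = refl

decode-encode : ∀ bs → decode (encode bs) ≡ bs
decode-encode []       = refl
decode-encode (b ∷ bs) = decode-runs b 0 bs

tabulate-injective : {A : Set} {f g : Fin n → A} → tabulate f ≡ tabulate g → ∀ i → f i ≡ g i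
tabulate-injective eq zero    = proj₁ (∷-injective eq)
tabulate-injective eq (suc i) = tabulate-injective (proj₂ (∷-injective eq)) i

Arcs : ℕ → Set
Arcs n = Fin n → Fin n → Bool

CoverticesOf ReverticesOf : Arcs n → Fin n → Fin n → Set
CoverticesOf A a b = a ≢ b × (∀ v → v ≢ a → v ≢ b → A a v ≡ A b v)
ReverticesOf A a b = a ≢ b × (∀ v → v ≢ a → v ≢ b → A a v ≡ A v b)

coverticesOf? : (A : Arcs n) (a b : Fin n) → Dec (CoverticesOf A a b)
coverticesOf? A a b =
  ¬? (a ≟ b) ×-dec all? λ v → ¬? (v ≟ a) →-dec ¬? (v ≟ b) →-dec A a v ≟ᵇ A b v

reverticesOf? : (A : Arcs n) (a b : Fin n) → Dec (ReverticesOf A a b)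
reverticesOf? A a b =
  ¬? (a ≟ b) ×-dec all? λ v → ¬? (v ≟ a) →-dec ¬? (v ≟ b) →-dec A a v ≟ᵇ A v b

skewOf : Arcs n → Matrix n
skewOf A i j = if A i j then 1ℤ else if A j i then - 1ℤ else 0ℤ

-- Unlike _*_, this does not evaluate its second argument when the first is 0.
_*₀_ : ℤ → ℤ → ℤ
(+ ℕ.zero) *₀ _ = 0ℤ
x          *₀ y = x * y

*₀≡* : ∀ x y → x *₀ y ≡ x * y
*₀≡* (+ ℕ.zero)  y = refl
*₀≡* (+ ℕ.suc _) y = refl
*₀≡* -[1+ _ ]    y = refl

-- The Laplace expansion of `det`, on a matrix stored as rows so that its entries are
-- computed only once; this is what makes the exhaustive check below feasible.
detRows : Vec (Vec ℤ n) n → ℤ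
detRows {ℕ.zero}  _        = 1ℤ
detRows {ℕ.suc n} (r ∷ rs) =
  sumFin λ j → signℤ (toℕ j) * (Vec.lookup r j *₀ detRows (Vec.map (λ row → removeAt row j) rs))

skewRows : (A : Arcs n) (Y : Subset n) → Vec (Vec ℤ (length (elems Y))) (length (elems Y))
skewRows A Y = Vec.tabulate λ i → Vec.tabulate λ j → skewOf A (lookup (elems Y) i) (lookup (elems Y) j)

detOf : Arcs n → Subset n → ℤ
detOf A Y = detRows (skewRows A Y)

sumFin-cong : {f g : Fin n → ℤ} → (∀ i → f i ≡ g i) → sumFin f ≡ sumFin g
sumFin-cong {ℕ.zero}  eq = refl
sumFin-cong {ℕ.suc n} eq = cong₂ _+_ (eq zero) (sumFin-cong (eq ∘ suc))

det-cong : {M N : Matrix n} → (∀ i j → M i j ≡ N i j) → det M ≡ det N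
det-cong {ℕ.zero}  eq = refl
det-cong {ℕ.suc n} eq = sumFin-cong λ j → cong₂ (λ x y → signℤ (toℕ j) * (x * y))
  (eq zero j) (det-cong λ k l → eq (suc k) (punchIn j l))

detRows≡det : (rows : Vec (Vec ℤ n) n) →
              detRows rows ≡ det (λ i j → Vec.lookup (Vec.lookup rows i) j)
detRows≡det {ℕ.zero}  _        = refl
detRows≡det {ℕ.suc n} (r ∷ rs) = sumFin-cong λ j → cong (signℤ (toℕ j) *_) (expand j)
  where
  open ≡-Reasoning
  minorRows : Fin (ℕ.suc n) → Vec (Vec ℤ n) n
  minorRows j = Vec.map (λ row → removeAt row j) rs
  minor-entry : ∀ j k l →
    Vec.lookup (Vec.lookup (minorRows j) k) l ≡ Vec.lookup (Vec.lookup rs k) (punchIn j l)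
  minor-entry j k l = trans (cong (λ row → Vec.lookup row l) (lookup-map k (λ row → removeAt row j) rs))
                            (removeAt-punchIn (Vec.lookup rs k) j l)
  expand : ∀ j → Vec.lookup r j *₀ detRows (minorRows j)
               ≡ Vec.lookup r j * det (λ k l → Vec.lookup (Vec.lookup rs k) (punchIn j l))
  expand j = begin
    Vec.lookup r j *₀ detRows (minorRows j)
      ≡⟨ *₀≡* (Vec.lookup r j) (detRows (minorRows j)) ⟩
    Vec.lookup r j * detRows (minorRows j)
      ≡⟨ cong (Vec.lookup r j *_) (detRows≡det (minorRows j)) ⟩
    Vec.lookup r j * det (λ k l → Vec.lookup (Vec.lookup (minorRows j) k) l)
      ≡⟨ cong (Vec.lookup r j *_) (det-cong (minor-entry j)) ⟩
    Vec.lookup r j * det (λ k l → Vec.lookup (Vec.lookup rs k) (punchIn j l)) ∎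

module _ (T : Tournament n) {A : Arcs n} (arc≡A : ∀ i j → arc T i j ≡ A i j) where

  covertices-from : ∀ {a b} → CoverticesOf A a b → Covertices T a b
  covertices-from (a≢b , same) = a≢b , λ v v≢a v≢b →
    trans (arc≡A _ v) (trans (same v v≢a v≢b) (sym (arc≡A _ v)))

  revertices-from : ∀ {a b} → ReverticesOf A a b → Revertices T a b
  revertices-from (a≢b , same) = a≢b , λ v v≢a v≢b →
    trans (arc≡A _ v) (trans (same v v≢a v≢b) (sym (arc≡A v _)))

  skew≡skewOf : ∀ i j → skew T i j ≡ skewOf A i j
  skew≡skewOf i j rewrite sym (arc≡A i j) | sym (arc≡A j i) with arc T i j | arc T j i
  ... | true  | _     = refl
  ... | false | true  = refl
  ... | false | false = refl

  detSub≡detOf : ∀ Y → detSub T Y ≡ detOf A Y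
  detSub≡detOf Y = trans (det-cong entries) (sym (detRows≡det (skewRows A Y)))
    where
    entries : ∀ i j → inducedSkew T Y i j ≡ Vec.lookup (Vec.lookup (skewRows A Y) i) j
    entry : Fin (length (elems Y)) → Fin (length (elems Y)) → ℤ
    entry i j = skewOf A (lookup (elems Y) i) (lookup (elems Y) j)
    entries i j rewrite lookup∘tabulate (λ i → Vec.tabulate (entry i)) i | lookup∘tabulate (entry i) j
      = skew≡skewOf _ _

-- A linear order inside a tournament fixes all of its arcs

module _ (T : Tournament n) {x : Fin m → Fin n}
         (ordered : ∀ a c → a <ᶠ c → arc T (x a) (x c) ≡ true) where

  ordered-distinct : ∀ {a c} → a <ᶠ c → x a ≢ x c
  ordered-distinct {a} {c} a<c xa≡xc
    with trans (sym (ordered a c a<c)) (trans (cong (arc T (x a)) (sym xa≡xc)) (irrefl T (x a)))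
  ... | ()

  ordered-injective : Injective _≡_ _≡_ x
  ordered-injective {a} {c} xa≡xc with <-cmp a c
  ... | tri< a<c _ _ = contradiction xa≡xc (ordered-distinct a<c)
  ... | tri≈ _ a≡c _ = a≡c
  ... | tri> _ _ c<a = contradiction (sym xa≡xc) (ordered-distinct c<a)

  ordered-arc : ∀ a c → arc T (x a) (x c) ≡ does (a <ᶠ? c)
  ordered-arc a c with <-cmp a c
  ... | tri< a<c _   _   = trans (ordered a c a<c) (sym (dec-true (a <ᶠ? c) a<c))
  ... | tri≈ a≮c refl _ = trans (irrefl T (x a)) (sym (dec-false (a <ᶠ? a) a≮c))
  ... | tri> a≮c _   c<a = begin
    arc T (x a) (x c)        ≡⟨ oneArc T (x c) (x a) (ordered-distinct c<a) ⟩
    not (arc T (x c) (x a))  ≡⟨ cong not (ordered c a c<a) ⟩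
    false                    ≡⟨ dec-false (a <ᶠ? c) a≮c ⟨
    does (a <ᶠ? c)           ∎
    where open ≡-Reasoning

data Vertex : Fin 7 → Set where
  inX : (k : Fin 5) → Vertex (vX k)
  isV6 : Vertex v6
  isV7 : Vertex v7

vertex : (i : Fin 7) → Vertex i
vertex zero                                   = inX (# 0)
vertex (suc zero)                             = inX (# 1)
vertex (suc (suc zero))                       = inX (# 2)
vertex (suc (suc (suc zero)))                 = inX (# 3)
vertex (suc (suc (suc (suc zero))))           = inX (# 4)
vertex (suc (suc (suc (suc (suc zero)))))     = isV6
vertex (suc (suc (suc (suc (suc (suc zero)))))) = isV7

v6≢vX : ∀ k → v6 ≢ vX k
v6≢vX k = ↑ˡ≢↑ʳ k (# 0) ∘ sym

v7≢vX : ∀ k → v7 ≢ vX k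
v7≢vX k = ↑ˡ≢↑ʳ k (# 1) ∘ sym

alternating : Fin n → Bool
alternating zero    = true
alternating (suc a) = not (alternating a)

-- ρ k is the position of vX k in the transitive order of X, d a says whether v₇ dominates
-- the vertex in position a, and b whether v₇ → v₆.
modelBetween : (ρ : Fin 5 → Fin 5) (d : Fin 5 → Bool) (b : Bool) →
               ∀ {i j} → Vertex i → Vertex j → Bool
modelBetween ρ d b (inX k) (inX l) = does (ρ k <ᶠ? ρ l)
modelBetween ρ d b (inX k) isV6    = not (alternating (ρ k))
modelBetween ρ d b (inX k) isV7    = not (d (ρ k))
modelBetween ρ d b isV6    (inX k) = alternating (ρ k)
modelBetween ρ d b isV7    (inX k) = d (ρ k)
modelBetween ρ d b isV6    isV6    = false
modelBetween ρ d b isV7    isV7    = false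
modelBetween ρ d b isV6    isV7    = not b
modelBetween ρ d b isV7    isV6    = b

model : (ρ : Fin 5 → Fin 5) (d : Vec Bool 5) (b : Bool) → Arcs 7
model ρ d b i j = modelBetween ρ (Vec.lookup d) b (vertex i) (vertex j)

runCount : Vec Bool 5 → ℕ
runCount d = length (encode (tabulate (Vec.lookup d)))

-- For each pattern with 3 or 4 runs, a position of X whose removal leaves a 6-vertex
-- subtournament of determinant 49 or 81 (found by computer search).
removable : Vec Bool 5 → Bool → Fin 5
removable (false ∷ false ∷ false ∷ true  ∷ false ∷ []) false = # 2
removable (false ∷ false ∷ false ∷ true  ∷ false ∷ []) true  = # 0
removable (false ∷ false ∷ true  ∷ false ∷ false ∷ []) _     = # 1
removable (false ∷ false ∷ true  ∷ false ∷ true  ∷ []) false = # 4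
removable (false ∷ false ∷ true  ∷ false ∷ true  ∷ []) true  = # 1
removable (false ∷ false ∷ true  ∷ true  ∷ false ∷ []) _     = # 0
removable (false ∷ true  ∷ false ∷ false ∷ false ∷ []) false = # 4
removable (false ∷ true  ∷ false ∷ false ∷ false ∷ []) true  = # 2
removable (false ∷ true  ∷ false ∷ false ∷ true  ∷ []) _     = # 0
removable (false ∷ true  ∷ false ∷ true  ∷ true  ∷ []) false = # 0
removable (false ∷ true  ∷ false ∷ true  ∷ true  ∷ []) true  = # 3
removable (false ∷ true  ∷ true  ∷ false ∷ false ∷ []) _     = # 1
removable (false ∷ true  ∷ true  ∷ false ∷ true  ∷ []) _     = # 2
removable (false ∷ true  ∷ true  ∷ true  ∷ false ∷ []) false = # 3
removable (false ∷ true  ∷ true  ∷ true  ∷ false ∷ []) true  = # 1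
removable (true  ∷ false ∷ false ∷ false ∷ true  ∷ []) false = # 1
removable (true  ∷ false ∷ false ∷ false ∷ true  ∷ []) true  = # 3
removable (true  ∷ false ∷ false ∷ true  ∷ false ∷ []) _     = # 2
removable (true  ∷ false ∷ false ∷ true  ∷ true  ∷ []) _     = # 1
removable (true  ∷ false ∷ true  ∷ false ∷ false ∷ []) false = # 3
removable (true  ∷ false ∷ true  ∷ false ∷ false ∷ []) true  = # 0
removable (true  ∷ false ∷ true  ∷ true  ∷ false ∷ []) _     = # 0
removable (true  ∷ false ∷ true  ∷ true  ∷ true  ∷ []) false = # 2
removable (true  ∷ false ∷ true  ∷ true  ∷ true  ∷ []) true  = # 4
removable (true  ∷ true  ∷ false ∷ false ∷ true  ∷ []) _     = # 0
removable (true  ∷ true  ∷ false ∷ true  ∷ false ∷ []) false = # 1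
removable (true  ∷ true  ∷ false ∷ true  ∷ false ∷ []) true  = # 4
removable (true  ∷ true  ∷ false ∷ true  ∷ true  ∷ []) _     = # 1
removable (true  ∷ true  ∷ true  ∷ false ∷ true  ∷ []) false = # 0
removable (true  ∷ true  ∷ true  ∷ false ∷ true  ∷ []) true  = # 2
removable _                                              _     = # 0

ModelClaim : (ρ : Fin 5 → Fin 5) (d : Vec Bool 5) (b : Bool) → Set
ModelClaim ρ d b =
    ((t ≡ 1 ⊎ t ≡ 2 ⊎ t ≡ 5) →
       Σ (Fin 6) λ i → CoverticesOf A v7 (inject₁ i) ⊎ ReverticesOf A v7 (inject₁ i))
  × ((t ≡ 3 ⊎ t ≡ 4) → ∃ λ k → ρ k ≡ removable d b × + 25 < detOf A (∁ ⁅ vX k ⁆))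
  where
  t : ℕ
  t = runCount d
  A : Arcs 7
  A = model ρ d b

modelClaim? : ∀ ρ d b → Dec (ModelClaim ρ d b)
modelClaim? ρ d b =
  ((t ℕ.≟ 1 ⊎-dec t ℕ.≟ 2 ⊎-dec t ℕ.≟ 5) →-dec
     any? λ i → coverticesOf? A v7 (inject₁ i) ⊎-dec reverticesOf? A v7 (inject₁ i))
  ×-dec ((t ℕ.≟ 3 ⊎-dec t ℕ.≟ 4) →-dec
     any? λ k → ρ k ≟ removable d b ×-dec + 25 <? detOf A (∁ ⁅ vX k ⁆))
  where
  t : ℕ
  t = runCount d
  A : Arcs 7
  A = model ρ d b

modelClaim : ∀ (r : Vec (Fin 5) 5) → Injective _≡_ _≡_ (Vec.lookup r) →
             ∀ d b → ModelClaim (Vec.lookup r) d b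
modelClaim = from-does (all-Vec? all? λ r → injective? (Vec.lookup r) →-dec
                          all-Vec? all-Bool? λ d → all-Bool? (modelClaim? (Vec.lookup r) d)) refl

-- Under the hypotheses of the corollary, T is the model tournament

module Decoding (T : Tournament 7) (π : Fin 5 → Fin 5) (ordered : IsTransOrder T π)
  (ψ₆ : psi T π v6 ≡ + 1 ∷ - (+ 1) ∷ + 1 ∷ - (+ 1) ∷ + 1 ∷ [])
  (ρ : Fin 5 → Fin 5) (πρ : ∀ k → π (ρ k) ≡ k) where

  pattern₇ : Vec Bool 5
  pattern₇ = Vec.tabulate λ a → arc T v7 (vX (π a))

  b : Bool
  b = arc T v7 v6

  v6-pattern : ∀ a → arc T v6 (vX (π a)) ≡ alternating a
  v6-pattern = tabulate-injective (begin
    tabulate (λ a → arc T v6 (vX (π a)))  ≡⟨ decode-encode _ ⟨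
    decode (psi T π v6)                   ≡⟨ cong decode ψ₆ ⟩
    tabulate alternating                  ∎)
    where open ≡-Reasoning

  inX-arc : ∀ k l → arc T (vX k) (vX l) ≡ does (ρ k <ᶠ? ρ l)
  inX-arc k l = trans (cong₂ (λ k l → arc T (vX k) (vX l)) (sym (πρ k)) (sym (πρ l)))
                      (ordered-arc T ordered (ρ k) (ρ l))

  v6-arc : ∀ k → arc T v6 (vX k) ≡ alternating (ρ k)
  v6-arc k = trans (cong (λ k → arc T v6 (vX k)) (sym (πρ k))) (v6-pattern (ρ k))

  v7-arc : ∀ k → arc T v7 (vX k) ≡ Vec.lookup pattern₇ (ρ k)
  v7-arc k = trans (cong (λ k → arc T v7 (vX k)) (sym (πρ k)))
                   (sym (lookup∘tabulate (λ a → arc T v7 (vX (π a))) (ρ k)))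

  arc≡model : ∀ i j → arc T i j ≡ model ρ pattern₇ b i j
  arc≡model i j = arcBetween (vertex i) (vertex j)
    where
    arcBetween : ∀ {i j} (vi : Vertex i) (vj : Vertex j) →
                 arc T i j ≡ modelBetween ρ (Vec.lookup pattern₇) b vi vj
    arcBetween (inX k) (inX l) = inX-arc k l
    arcBetween (inX k) isV6    = trans (oneArc T v6 (vX k) (v6≢vX k)) (cong not (v6-arc k))
    arcBetween (inX k) isV7    = trans (oneArc T v7 (vX k) (v7≢vX k)) (cong not (v7-arc k))
    arcBetween isV6    (inX k) = v6-arc k
    arcBetween isV7    (inX k) = v7-arc k
    arcBetween isV6    isV6    = irrefl T v6
    arcBetween isV7    isV7    = irrefl T v7
    arcBetween isV6    isV7    = oneArc T v7 v6 λ ()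
    arcBetween isV7    isV6    = refl

  ψ₇ : psi T π v7 ≡ encode (tabulate (Vec.lookup pattern₇))
  ψ₇ = cong encode (tabulate-cong λ a → sym (lookup∘tabulate (λ a → arc T v7 (vX (π a))) a))

module Transport (T : Tournament 7) (ρ : Fin 5 → Fin 5) (d : Vec Bool 5) (b : Bool)
         (arc≡model : ∀ i j → arc T i j ≡ model ρ d b i j)
         (claim : ModelClaim ρ d b) where

  covertex-or-revertex : runCount d ≡ 1 ⊎ runCount d ≡ 2 ⊎ runCount d ≡ 5 →
    Σ (Fin 6) λ i → Covertices T v7 (inject₁ i) ⊎ Revertices T v7 (inject₁ i)
  covertex-or-revertex t∈125 =
    let i , co-or-re = proj₁ claim t∈125
    in  i , Sum.map (covertices-from T arc≡model) (revertices-from T arc≡model) co-or-re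

  ∉𝒟₅ : runCount d ≡ 3 ⊎ runCount d ≡ 4 → ¬ InD5 T
  ∉𝒟₅ t∈34 inD5 =
    let k , _ , 25<det = proj₂ claim t∈34
        Y              = ∁ ⁅ vX k ⁆
        v6∈Y           = x∉p⇒x∈∁p (x≢y⇒x∉⁅y⁆ (v6≢vX k))
    in  <⇒≱ 25<det (subst (_≤ + 25) (detSub≡detOf T arc≡model Y) (inD5 Y (v6 , v6∈Y)))

corollary3p8 : (T : Tournament 7) → SixIsoL6 T → TransitiveX T →
    (π : Fin 5 → Fin 5) → IsTransOrder T π →
    psi T π v6 ≡ + 1 ∷ - (+ 1) ∷ + 1 ∷ - (+ 1) ∷ + 1 ∷ [] →
    ((length (psi T π v7) ≡ 1 ⊎ length (psi T π v7) ≡ 2 ⊎ length (psi T π v7) ≡ 5) →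
       Σ (Fin 6) λ i → Covertices T v7 (inject₁ i) ⊎ Revertices T v7 (inject₁ i))
    × ((length (psi T π v7) ≡ 3 ⊎ length (psi T π v7) ≡ 4) → ¬ InD5 T)
corollary3p8 T _ _ π ordered ψ₆ =
    covertex-or-revertex ∘ subst (λ t → t ≡ 1 ⊎ t ≡ 2 ⊎ t ≡ 5) t≡
  , ∉𝒟₅ ∘ subst (λ t → t ≡ 3 ⊎ t ≡ 4) t≡
  where
  π-surjective : ∀ k → ∃ λ a → π a ≡ k
  π-surjective = injective⇒surjective (ordered-injective T ordered ∘ cong vX)

  ranks : Vec (Fin 5) 5
  ranks = Vec.tabulate (proj₁ ∘ π-surjective)

  πρ : ∀ k → π (Vec.lookup ranks k) ≡ k
  πρ k = trans (cong π (lookup∘tabulate (proj₁ ∘ π-surjective) k)) (proj₂ (π-surjective k))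

  open Decoding T π ordered ψ₆ (Vec.lookup ranks) πρ

  claim : ModelClaim (Vec.lookup ranks) pattern₇ b
  claim = modelClaim ranks (λ eq → trans (sym (πρ _)) (trans (cong π eq) (πρ _))) pattern₇ b

  t≡ : length (psi T π v7) ≡ runCount pattern₇
  t≡ = cong length ψ₇

  open Transport T (Vec.lookup ranks) pattern₇ b arc≡model claim
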